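{- Let $\mathbb{F}$ be an infinite field of characteristic $0$ and let $n$ be a positive integer. Then the algebra $(\mathcal{M}_n(\mathbb{F}),\mathbb{F},\times_\mathbb{F},|\ast|)$ is not an $\vec{e}$-Ramsey algebra for any nonconstant $\vec{e}\in\Omega_0$.
   Context: An algebra is a pair $(\{A_\xi\}_{\xi\in I},\mathcal{F})$ with nonempty, pairwise disjoint phyla and a family $\mathcal{F}$ of operations, each with domain a finite product of phyla and codomain a phylum. A sort is $\vec{e}\in{}^\omega I$, and $\vec{b}$ is $\vec{e}$-sorted if $\vec{b}(i)\in A_{\vec{e}(i)}$ for all $i$. Orderly terms: $\mathcal{F}_0=\mathcal{F}\cup\{\mathrm{id}_{A_\xi}\}$. $\mathcal{F}_{k+1}$ is $\mathcal{F}_k$ plus all $f$ with $f(\vec{x})=g(h_1(\vec{x}_1),\dots,h_N(\vec{x}_N))$, where $g\in\mathcal{F}$ is $N$-ary, $h_i\in\mathcal{F}_k$, and $\vec{x}_1\ast\cdots\ast\vec{x}_N=\vec{x}$ is the argument list of $f$ (concatenation). $\mathrm{OT}(\mathcal{F})=\bigcup_k\mathcal{F}_k$. $\vec{a}\le_\mathcal{F}\vec{b}$ means: for each $j$ there are a finite subsequence $\vec{b}_j$ of $\vec{b}$ and $f_j\in\mathrm{OT}(\mathcal{F})$ with $\vec{a}(j)=f_j(\vec{b}_j)$, and $\vec{b}_0\ast\vec{b}_1\ast\cdots$ is a subsequence of $\vec{b}$. $\mathrm{FR}^{\vec{e}}_\mathcal{F}(\vec{b})=\{\vec{a}(0):\vec{a}\le_\mathcal{F}\vec{b},\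 \vec{a}\ \vec{e}\text{ -sorted}\}$. $\vec{e}$-Ramsey algebra: for every $\vec{e}$-sorted $\vec{b}$ and $X\subseteq A_{\vec{e}(0)}$ some $\vec{e}$-sorted $\vec{a}\le_\mathcal{F}\vec{b}$ has $\mathrm{FR}^{\vec{e}}_\mathcal{F}(\vec{a})\subseteq X$ or disjoint from $X$. $\Omega$ is the set of sorts each of whose values is taken infinitely often, and $\Omega_0=\{\vec{e}\in\Omega:\vec{e}(0)=0\}$. The phyla are $A_0=\mathbb{F}$ (index $0$) and $A_1=\mathcal{M}_n(\mathbb{F})$ of $n\times n$ matrices over $\mathbb{F}$ (index $1$), regarded as disjoint. The operations are field multiplication $\times_\mathbb{F}$ and the determinant $|\ast|:\mathcal{M}_n(\mathbb{F})\to\mathbb{F}$. -}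

module Defs where

open import Level using (Level; _⊔_)
open import Algebra.Bundles using (CommutativeRing)
open import Data.Nat using (ℕ; zero; suc; _≤_; _<_)
import Data.Nat as ℕ
open import Data.Fin using (Fin; zero; suc; punchIn)
import Data.Fin
open import Data.List using (List; []; _∷_; _++_; map)
open import Data.List.Membership.Propositional using (_∈_)
open import Data.List.Relation.Unary.AllPairs using (AllPairs)
open import Data.Product using (Σ; ∃; _×_; _,_)
open import Data.Sum using (_⊎_)
open import Data.Unit.Polymorphic using (⊤; tt)
open import Relation.Nullary using (¬_)
open import Relation.Binary.PropositionalEquality using (_≡_; _≢_)
import Algebra.Definitions.RawMonoid as RawMonoidDefs

record Field (c ℓ : Level) : Set (Level.suc (c ⊔ ℓ)) where
  field
    commutativeRing : CommutativeRing c ℓ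
  open CommutativeRing commutativeRing public
  field
    1≉0     : ¬ (1# ≈ 0#)
    inverse : ∀ x → ¬ (x ≈ 0#) → ∃ λ y → (x * y) ≈ 1#

module FieldNotions {c ℓ} (F : Field c ℓ) where
  open Field F using (Carrier; _≈_; 0#; 1#; +-rawMonoid)
  open RawMonoidDefs +-rawMonoid using () renaming (_×_ to _·_)

  Char0 : Set ℓ
  Char0 = ∀ (m : ℕ) → ¬ (ℕ.suc m · 1# ≈ 0#)

  Infinite : Set (c ⊔ ℓ)
  Infinite = ∀ (l : List Carrier) → ∃ λ x → ∀ y → y ∈ l → ¬ (x ≈ y)

module Det {c ℓ} (R : CommutativeRing c ℓ) where
  open CommutativeRing R using (Carrier; _+_; _*_; -_; 0#; 1#)

  Matrix : ℕ → Set c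
  Matrix n = Fin n → Fin n → Carrier

  sumFin : ∀ {n} → (Fin n → Carrier) → Carrier
  sumFin {zero}  f = 0#
  sumFin {suc n} f = f zero + sumFin (λ j → f (suc j))

  altSign : ℕ → Carrier
  altSign zero    = 1#
  altSign (suc k) = - altSign k

  minor : ∀ {n} → Fin (suc n) → Matrix (suc n) → Matrix n
  minor j M i k = M (suc i) (punchIn j k)

  det : ∀ {n} → Matrix n → Carrier
  det {zero}  M = 1#
  det {suc n} M = sumFin (λ j → altSign (Data.Fin.toℕ j) * (M zero j * det (minor j M)))

-- The two-phyla algebra (M_n(F), F, ×_F, |∗|) and its orderly terms.
-- Phylum index 0 is F, phylum index 1 is M_n(F).

data Phy : Set where
  p0 p1 : Phy

module MatrixAlgebra {c ℓ} (F : Field c ℓ) (n : ℕ) where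
  open Field F using (Carrier; _≈_; _*_; commutativeRing)
  open Det commutativeRing

  El : Phy → Set c
  El p0 = Carrier
  El p1 = Matrix n

  EqE : (ξ : Phy) → El ξ → El ξ → Set ℓ
  EqE p0 x y = x ≈ y
  EqE p1 A B = ∀ i j → A i j ≈ B i j

  -- Orderly terms OT(ℱ), indexed by the sorts of their argument list and
  -- their codomain.  ℱ = {×_F, det}; identities id_{A_ξ} are the base case.
  -- mulT / detT compose an operation g ∈ ℱ with orderly terms on
  -- concatenated argument lists (the operations of ℱ₀ themselves are
  -- mulT (idT p0) (idT p0) and detT (idT p1)).
  data Term : List Phy → Phy → Set where
    idT  : (ξ : Phy) → Term (ξ ∷ []) ξ
    mulT : ∀ {xs ys} → Term xs p0 → Term ys p0 → Term (xs ++ ys) p0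
    detT : ∀ {xs} → Term xs p1 → Term xs p0

  Args : List Phy → Set c
  Args []       = ⊤
  Args (ξ ∷ xs) = El ξ × Args xs

  splitArgs : ∀ xs {ys} → Args (xs ++ ys) → Args xs × Args ys
  splitArgs []       as       = tt , as
  splitArgs (x ∷ xs) (a , as) with splitArgs xs as
  ... | (l , r) = (a , l) , r

  ⟦_⟧ : ∀ {xs ξ} → Term xs ξ → Args xs → El ξ
  ⟦ idT ξ ⟧ (a , tt) = a
  ⟦ mulT {xs} {ys} g h ⟧ as with splitArgs xs {ys} as
  ... | (l , r) = ⟦ g ⟧ l * ⟦ h ⟧ r
  ⟦ detT g ⟧ as = det (⟦ g ⟧ as)

  Sort : Set
  Sort = ℕ → Phy

  Seq : Sort → Set c
  Seq e = (i : ℕ) → El (e i)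

  pick : ∀ {e} → Seq e → (is : List ℕ) → Args (map e is)
  pick b []       = tt
  pick b (i ∷ is) = b i , pick b is

  -- Le e e' a b  (a ≤_ℱ b) for e-sorted a and e'-sorted b: a(j) = f_j(b_j) where b_j is the
  -- subsequence of b at the strictly increasing index list idx j, and
  -- b_0 ∗ b_1 ∗ ⋯ is a subsequence of b (all indices of block j lie below
  -- all indices of block k whenever j < k).
  record Le (e e' : Sort) (a : Seq e) (b : Seq e') : Set (c ⊔ ℓ) where
    field
      idx        : ℕ → List ℕ
      term       : (j : ℕ) → Term (map e' (idx j)) (e j)
      blockIncr  : ∀ j → AllPairs _<_ (idx j)
      blocksIncr : ∀ j k → j < k → ∀ p q → p ∈ idx j → q ∈ idx k → p < q
      value      : ∀ j → EqE (e j) (a j) (⟦ term j ⟧ (pick {e'} b (idx j)))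

  FR : (e : Sort) → Seq e → El (e zero) → Set (c ⊔ ℓ)
  FR e b x = ∃ λ (a : Seq e) → Le e e a b × EqE (e zero) (a zero) x

  Subset : Phy → Set (Level.suc (c ⊔ ℓ))
  Subset ξ = Σ (El ξ → Set (c ⊔ ℓ)) λ X → ∀ {x y} → EqE ξ x y → X x → X y

  IsRamsey : Sort → Set (Level.suc (c ⊔ ℓ))
  IsRamsey e = ∀ (b : Seq e) (X : Subset (e zero)) →
    let P = Data.Product.proj₁ X in
    ∃ λ (a : Seq e) → Le e e a b ×
      ((∀ x → FR e a x → P x) ⊎ (∀ x → FR e a x → ¬ P x))

InΩ : (ℕ → Phy) → Set
InΩ e = ∀ i N → ∃ λ k → N ≤ k × e k ≡ e i

InΩ₀ : (ℕ → Phy) → Set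
InΩ₀ e = InΩ e × e zero ≡ p0

Nonconstant : (ℕ → Phy) → Set
Nonconstant e = ∃ λ i → e i ≢ e zero

module Submission where

-- Seed the algebra with the sequence b that puts 1 in every
-- field position and the diagonal matrix J = diag(-1,1,…,1) in every matrix
-- position.  An element is called *signed* if it is a scalar ±1 or a matrix
-- equal to J.  Since |J| = -1 and (±1)(±1) = ±1, every orderly term maps
-- signed arguments to signed values, so every a ≤_ℱ b is signed everywhere.
-- Colour the field by X = {1}.  For any a ≤_ℱ b and any matrix position
-- j > 0 (it exists because e is nonconstant), both a(0) and a(0)·|a(j)|
-- lie in FR(a): the latter is the head of a reduction of a whose tail is
-- re-sampled far out along e, which is possible because e ∈ Ω.  Since
-- a(0)·|a(j)| = -a(0) and -1 ≠ 1 in characteristic 0, exactly one of the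
-- two lies in X, so FR(a) is never homogeneous.

open import Defs
open import Level using (Level; _⊔_; Lift; lift)
open import Algebra.Bundles using (CommutativeRing)
open import Data.Nat using (ℕ; zero; suc; _≤_; _<_; z≤n; s≤s)
import Data.Nat.Properties as ℕ
open import Data.Fin using (Fin; zero; suc; toℕ; punchIn)
open import Data.List using (List; []; _∷_; _++_; map)
open import Data.List.Membership.Propositional using (_∈_)
open import Data.List.Relation.Unary.Any using (here; there)
open import Data.List.Relation.Unary.All using ([]; _∷_)
open import Data.List.Relation.Unary.AllPairs using (AllPairs; []; _∷_)
open import Data.Product using (∃; _×_; _,_; proj₁; proj₂)
open import Data.Sum using (_⊎_; inj₁; inj₂)
open import Data.Unit.Polymorphic using (⊤; tt)
open import Data.Empty using (⊥-elim)
open import Relation.Nullary using (¬_)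
open import Relation.Binary.PropositionalEquality using (_≡_; _≢_; refl; sym; trans)
import Algebra.Properties.Ring as RingProperties
import Relation.Binary.Reasoning.Setoid as SetoidReasoning

module DeterminantLemmas {c ℓ} (R : CommutativeRing c ℓ) where
  open CommutativeRing R hiding (zero)
    renaming (refl to ≈-refl; trans to ≈-trans)
  open Det R
  open SetoidReasoning setoid

  sumFin-cong : ∀ {k} {f g : Fin k → Carrier} → (∀ j → f j ≈ g j) → sumFin f ≈ sumFin g
  sumFin-cong {zero}  f≈g = ≈-refl
  sumFin-cong {suc k} f≈g = +-cong (f≈g zero) (sumFin-cong (λ j → f≈g (suc j)))

  sumFin-zero : ∀ {k} {f : Fin k → Carrier} → (∀ j → f j ≈ 0#) → sumFin f ≈ 0#
  sumFin-zero {zero}  f≈0 = ≈-refl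
  sumFin-zero {suc k} f≈0 = ≈-trans (+-cong (f≈0 zero) (sumFin-zero (λ j → f≈0 (suc j)))) (+-identityʳ 0#)

  det-cong : ∀ {k} {M N : Matrix k} → (∀ i j → M i j ≈ N i j) → det M ≈ det N
  det-cong {zero}  M≈N = ≈-refl
  det-cong {suc k} M≈N = sumFin-cong λ j →
    *-cong (≈-refl {altSign (toℕ j)}) (*-cong (M≈N zero j) (det-cong (λ i l → M≈N (suc i) (punchIn j l))))

  corner : ∀ {k} → Carrier → Matrix k
  corner d zero    zero    = d
  corner d zero    (suc _) = 0#
  corner d (suc _) zero    = 0#
  corner d (suc i) (suc l) = corner 1# i l

  -- Expanding along the first row, only the (0,0) entry contributes.
  det-corner : ∀ k d → det {suc k} (corner d) ≈ d
  det-identity : ∀ k → det {k} (corner 1#) ≈ 1#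

  det-corner k d = begin
    altSign 0 * (d * det {k} (corner 1#)) + sumFin offDiagonal ≈⟨ +-cong (*-identityˡ _) (sumFin-zero offDiagonal≈0) ⟩
    d * det {k} (corner 1#) + 0#                                ≈⟨ +-identityʳ _ ⟩
    d * det {k} (corner 1#)                                     ≈⟨ *-cong ≈-refl (det-identity k) ⟩
    d * 1#                                                      ≈⟨ *-identityʳ d ⟩
    d                                                           ∎
    where
      offDiagonal : Fin k → Carrier
      offDiagonal j = altSign (toℕ (suc j)) * (0# * det (minor (suc j) (corner {suc k} d)))
      offDiagonal≈0 : ∀ j → offDiagonal j ≈ 0#
      offDiagonal≈0 j = ≈-trans (*-cong ≈-refl (zeroˡ _)) (zeroʳ _)

  det-identity zero    = ≈-refl
  det-identity (suc k) = det-corner k 1#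

module Reductions {c ℓ} (F : Field c ℓ) (n : ℕ) where
  open MatrixAlgebra F n

  EqE-refl : ∀ ξ (x : El ξ) → EqE ξ x x
  EqE-refl p0 x     = Field.refl F
  EqE-refl p1 x i j = Field.refl F

  ≤-refl : ∀ e (a : Seq e) → Le e e a a
  ≤-refl e a = record
    { idx        = λ k → k ∷ []
    ; term       = λ k → idT (e k)
    ; blockIncr  = λ k → [] ∷ []
    ; blocksIncr = λ { j k j<k p q (here refl) (here refl) → j<k }
    ; value      = λ k → EqE-refl (e k) (a k) }

  head∈FR : ∀ e (a : Seq e) → FR e a (a zero)
  head∈FR e a = a , ≤-refl e a , EqE-refl (e zero) (a zero)

  scaleByDet : ∀ {ξ ζ} → ξ ≡ p0 → ζ ≡ p1 → Term (ξ ∷ ζ ∷ []) ξ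
  scaleByDet refl refl = mulT (idT p0) (detT (idT p1))

  castId : ∀ {ξ ζ} → ξ ≡ ζ → Term (ξ ∷ []) ζ
  castId refl = idT _

  -- If e ∈ Ω, e(0) = F and e(j) = M_n(F) with j > 0, then a(0)·|a(j)| ∈ FR(a):
  -- it heads the reduction whose later entries are a(σ(1)), a(σ(2)), …, where
  -- σ is strictly increasing, starts at j and matches the sort of e.
  scaled∈FR : ∀ e → InΩ e → ∀ j → 0 < j → (e0 : e zero ≡ p0) (ej : e j ≡ p1) (a : Seq e) →
              FR e a (⟦ scaleByDet e0 ej ⟧ (a zero , a j , tt))
  scaled∈FR e Ω j 0<j e0 ej a = reduct , reduct≤a , EqE-refl (e zero) (reduct zero)
    where
      σ : ℕ → ℕ
      σ zero    = j
      σ (suc i) = proj₁ (Ω (suc i) (suc (σ i)))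

      σ-step : ∀ i → σ i < σ (suc i)
      σ-step i = proj₁ (proj₂ (Ω (suc i) (suc (σ i))))

      σ-sort : ∀ i → e (σ (suc i)) ≡ e (suc i)
      σ-sort i = proj₂ (proj₂ (Ω (suc i) (suc (σ i))))

      σ-increasing : ∀ i k → i < k → σ i < σ k
      σ-increasing i (suc k) (s≤s i≤k) with ℕ.m≤n⇒m<n∨m≡n i≤k
      ... | inj₁ i<k  = ℕ.<-trans (σ-increasing i k i<k) (σ-step k)
      ... | inj₂ refl = σ-step k

      blocks : ℕ → List ℕ
      blocks zero    = 0 ∷ j ∷ []
      blocks (suc i) = σ (suc i) ∷ []

      blocks≤σ : ∀ i p → p ∈ blocks i → p ≤ σ i
      blocks≤σ zero    p (here refl)         = z≤n
      blocks≤σ zero    p (there (here refl)) = ℕ.≤-refl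
      blocks≤σ (suc i) p (here refl)         = ℕ.≤-refl

      blocksIncreasing : ∀ i k → i < k → ∀ p q → p ∈ blocks i → q ∈ blocks k → p < q
      blocksIncreasing i (suc k) i<k p q p∈ (here refl) =
        ℕ.≤-<-trans (blocks≤σ i p p∈) (σ-increasing i (suc k) i<k)

      blockIncreasing : ∀ i → AllPairs _<_ (blocks i)
      blockIncreasing zero    = (0<j ∷ []) ∷ [] ∷ []
      blockIncreasing (suc i) = [] ∷ []

      terms : (k : ℕ) → Term (map e (blocks k)) (e k)
      terms zero    = scaleByDet e0 ej
      terms (suc k) = castId (σ-sort k)

      reduct : Seq e
      reduct k = ⟦ terms k ⟧ (pick {e} a (blocks k))

      reduct≤a : Le e e reduct a
      reduct≤a = record
        { idx = blocks ; term = terms ; blockIncr = blockIncreasing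
        ; blocksIncr = blocksIncreasing ; value = λ k → EqE-refl (e k) (reduct k) }

module SignedElements {c ℓ} (F : Field c ℓ) (m : ℕ) where
  open Field F using (_≈_; _*_; -_; 1#; commutativeRing; ring; *-cong; *-identityˡ; *-identityʳ)
    renaming (refl to ≈-refl; trans to ≈-trans)
  open Det commutativeRing using (det; Matrix)
  open DeterminantLemmas commutativeRing using (corner; det-corner; det-cong)
  open MatrixAlgebra F (suc m)
  open RingProperties ring using (-1*x≈-x; -‿involutive)

  J : Matrix (suc m)
  J = corner (- 1#)

  Signed : (ξ : Phy) → El ξ → Set ℓ
  Signed p0 x = x ≈ 1# ⊎ x ≈ - 1#
  Signed p1 A = ∀ i j → A i j ≈ J i j

  Signed-resp : ∀ ξ {x y} → EqE ξ x y → Signed ξ y → Signed ξ x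
  Signed-resp p0 x≈y (inj₁ y≈1)  = inj₁ (≈-trans x≈y y≈1)
  Signed-resp p0 x≈y (inj₂ y≈-1) = inj₂ (≈-trans x≈y y≈-1)
  Signed-resp p1 A≈B B≈J i j     = ≈-trans (A≈B i j) (B≈J i j)

  det-signed : ∀ {A} → Signed p1 A → det A ≈ - 1#
  det-signed A≈J = ≈-trans (det-cong A≈J) (det-corner m (- 1#))

  -1*-1≈1 : - 1# * - 1# ≈ 1#
  -1*-1≈1 = ≈-trans (-1*x≈-x (- 1#)) (-‿involutive 1#)

  *-signed : ∀ {x y} → Signed p0 x → Signed p0 y → Signed p0 (x * y)
  *-signed (inj₁ x≈1)  (inj₁ y≈1)  = inj₁ (≈-trans (*-cong x≈1 y≈1) (*-identityˡ 1#))
  *-signed (inj₁ x≈1)  (inj₂ y≈-1) = inj₂ (≈-trans (*-cong x≈1 y≈-1) (*-identityˡ _))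
  *-signed (inj₂ x≈-1) (inj₁ y≈1)  = inj₂ (≈-trans (*-cong x≈-1 y≈1) (*-identityʳ _))
  *-signed (inj₂ x≈-1) (inj₂ y≈-1) = inj₁ (≈-trans (*-cong x≈-1 y≈-1) -1*-1≈1)

  AllSigned : ∀ xs → Args xs → Set ℓ
  AllSigned []       _        = ⊤
  AllSigned (ξ ∷ xs) (a , as) = Signed ξ a × AllSigned xs as

  splitArgs-signed : ∀ xs {ys} (as : Args (xs ++ ys)) → AllSigned (xs ++ ys) as →
    AllSigned xs (proj₁ (splitArgs xs {ys} as)) × AllSigned ys (proj₂ (splitArgs xs {ys} as))
  splitArgs-signed []       as       s = tt , s
  splitArgs-signed (x ∷ xs) {ys} (a , as) (sa , sas)
    with splitArgs xs {ys} as | splitArgs-signed xs {ys} as sas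
  ... | l , r | sl , sr = (sa , sl) , sr

  -- The invariant: orderly terms preserve signedness (|J| = -1, (±1)(±1) = ±1).
  term-signed : ∀ {xs ξ} (t : Term xs ξ) (as : Args xs) → AllSigned xs as → Signed ξ (⟦ t ⟧ as)
  term-signed (idT ξ) (a , tt) (sa , _) = sa
  term-signed (mulT {xs} {ys} g h) as s with splitArgs xs {ys} as | splitArgs-signed xs {ys} as s
  ... | l , r | sl , sr = *-signed (term-signed g l sl) (term-signed h r sr)
  term-signed (detT g) as s = inj₂ (det-signed (term-signed g as s))

  pick-signed : ∀ {e} (b : Seq e) → (∀ i → Signed (e i) (b i)) → ∀ is → AllSigned (map e is) (pick {e} b is)
  pick-signed b s []       = tt
  pick-signed b s (i ∷ is) = s i , pick-signed b s is

  seed : ∀ ξ → El ξ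
  seed p0 = 1#
  seed p1 = J

  seed-signed : ∀ ξ → Signed ξ (seed ξ)
  seed-signed p0     = inj₁ ≈-refl
  seed-signed p1 i j = ≈-refl

  reduction-signed : ∀ {e} (a : Seq e) → Le e e a (λ i → seed (e i)) → ∀ i → Signed (e i) (a i)
  reduction-signed {e} a a≤seed i = Signed-resp (e i) (Le.value a≤seed i)
    (term-signed (Le.term a≤seed i) _ (pick-signed (λ k → seed (e k)) (λ k → seed-signed (e k)) (Le.idx a≤seed i)))

module Separation {c ℓ} (F : Field c ℓ) (char0 : FieldNotions.Char0 F) (m : ℕ) where
  open Field F using (_≈_; _+_; _*_; -_; 1#; +-cong; +-identityʳ; -‿inverseˡ; *-cong; *-identityˡ)
    renaming (sym to ≈-sym; trans to ≈-trans)
  open Det (Field.commutativeRing F) using (det)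
  open MatrixAlgebra F (suc m)
  open Reductions F (suc m) using (scaleByDet; head∈FR; scaled∈FR)
  open SignedElements F m

  -- In characteristic 0, 1 + 1 ≉ 0, hence -1 ≉ 1.
  -1≉1 : ¬ (- 1# ≈ 1#)
  -1≉1 -1≈1 = char0 1 (≈-trans (+-cong (≈-sym -1≈1) (+-identityʳ 1#)) (-‿inverseˡ 1#))

  isOne : ∀ {ξ} → ξ ≡ p0 → Subset ξ
  isOne refl = (λ x → Lift c (x ≈ 1#)) , λ x≈y (lift y≈1) → lift (≈-trans (≈-sym x≈y) y≈1)

  separates : ∀ {ξ ζ} (p : ξ ≡ p0) (q : ζ ≡ p1) {u v} → Signed ξ u → Signed ζ v →
    let One = proj₁ (isOne p); w = ⟦ scaleByDet p q ⟧ (u , v , tt) in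
    (One u → ¬ One w) × (¬ One u → One w)
  separates refl refl {u} {v} su sv = oneThenMinusOne , notOneThenOne su
    where
      oneThenMinusOne : Lift c (u ≈ 1#) → ¬ Lift c (u * det v ≈ 1#)
      oneThenMinusOne (lift u≈1) (lift w≈1) =
        -1≉1 (≈-trans (≈-sym (≈-trans (*-cong u≈1 (det-signed sv)) (*-identityˡ _))) w≈1)
      notOneThenOne : Signed p0 u → ¬ Lift c (u ≈ 1#) → Lift c (u * det v ≈ 1#)
      notOneThenOne (inj₁ u≈1)  u≉1 = ⊥-elim (u≉1 (lift u≈1))
      notOneThenOne (inj₂ u≈-1) u≉1 = lift (≈-trans (*-cong u≈-1 (det-signed sv)) -1*-1≈1)

  -- No reduction a of the seed along e ∈ Ω with a matrix position j > 0 is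
  -- homogeneous for X: a(0) and a(0)·|a(j)| both lie in FR(a), exactly one in X.
  notHomogeneous : ∀ e → InΩ e → ∀ j → 0 < j → (e0 : e zero ≡ p0) → e j ≡ p1 →
    let One = proj₁ (isOne e0) in
    ¬ (∃ λ (a : Seq e) → Le e e a (λ k → seed (e k)) ×
         ((∀ x → FR e a x → One x) ⊎ (∀ x → FR e a x → ¬ One x)))
  notHomogeneous e Ω j 0<j e0 ej (a , a≤seed , homogeneous) = refute homogeneous
    where
      One : El (e zero) → Set (c ⊔ ℓ)
      One = proj₁ (isOne e0)
      scaled : El (e zero)
      scaled = ⟦ scaleByDet e0 ej ⟧ (a zero , a j , tt)
      head∈ : FR e a (a zero)
      head∈ = head∈FR e a
      scaled∈ : FR e a scaled
      scaled∈ = scaled∈FR e Ω j 0<j e0 ej a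
      split : (One (a zero) → ¬ One scaled) × (¬ One (a zero) → One scaled)
      split = separates e0 ej (reduction-signed a a≤seed zero) (reduction-signed a a≤seed j)
      refute : ¬ ((∀ x → FR e a x → One x) ⊎ (∀ x → FR e a x → ¬ One x))
      refute (inj₁ allIn)  = proj₁ split (allIn _ head∈) (allIn _ scaled∈)
      refute (inj₂ noneIn) = noneIn _ scaled∈ (proj₂ split (noneIn _ head∈))

otherPhylum : ∀ {ξ} → ξ ≢ p0 → ξ ≡ p1
otherPhylum {p0} ξ≢p0 = ⊥-elim (ξ≢p0 refl)
otherPhylum {p1} ξ≢p0 = refl

mainTheorem17 : ∀ {c ℓ : Level} (F : Field c ℓ) → FieldNotions.Infinite F → FieldNotions.Char0 F →
                  (n : ℕ) → 1 ≤ n → (e : ℕ → Phy) → InΩ₀ e → Nonconstant e →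
                  ¬ MatrixAlgebra.IsRamsey F n e
mainTheorem17 F _ char0 (suc m) _ e (Ω , e0) (zero , e0≢e0) ramsey = e0≢e0 refl
mainTheorem17 F _ char0 (suc m) _ e (Ω , e0) (suc i , ej≢e0) ramsey =
  notHomogeneous e Ω (suc i) (s≤s z≤n) e0 ej (ramsey (λ k → seed (e k)) (isOne e0))
  where
    open SignedElements F m using (seed)
    open Separation F char0 m using (isOne; notHomogeneous)
    ej : e (suc i) ≡ p1
    ej = otherPhylum (λ ej≡p0 → ej≢e0 (trans ej≡p0 (sym e0)))
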